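{- Let $k\geqslant 1$ and $m\geqslant 1$ be integers. Then $$R_k(k^2m)=R_k(m)+(k^2-k)m.$$
   Context: A set $A\subset \mathbb{Z}/n\mathbb{Z}$ is called $k$-free if for all $x\in A$, $kx\notin A$. $R_k(n)$ denotes the maximal cardinality of a $k$-free subset of $\mathbb{Z}/n\mathbb{Z}$. -}

module Defs where

open import Data.Nat using (ℕ; zero; suc; _*_; _%_; _≤_; NonZero)
open import Data.Nat.DivMod using (m%n<n)
open import Data.Fin using (Fin; toℕ; fromℕ<)
open import Data.Fin.Subset using (Subset; _∈_; _∉_; ∣_∣)
open import Data.Product using (Σ; _×_)

-- Multiplication by the integer k on ℤ/nℤ, where ℤ/nℤ is modelled as Fin n
-- (residues 0 .. n-1) and n ≠ 0.
mulMod : (n : ℕ) .{{_ : NonZero n}} → ℕ → Fin n → Fin n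
mulMod n k x = fromℕ< (m%n<n (k * toℕ x) n)

KFree : (n : ℕ) .{{_ : NonZero n}} → ℕ → Subset n → Set
KFree n k A = ∀ x → x ∈ A → mulMod n k x ∉ A

IsRk : ℕ → (n : ℕ) .{{_ : NonZero n}} → ℕ → Set
IsRk k n r = Σ (Subset n) (λ A → KFree n k A × ∣ A ∣ ≡ r)
             × (∀ (A : Subset n) → KFree n k A → ∣ A ∣ ≤ r)
  where open import Relation.Binary.PropositionalEquality using (_≡_)

-- Sort the residues mod k²m by their k-adic valuation. On k²·(ℤ/mℤ) ≅ ℤ/mℤ multiplication by k acts
-- as multiplication by k on ℤ/mℤ, so a k-free set has at most R_k(m) elements there. The remaining
-- residues fall into m(k−1) groups: an element (wk+s)k with 0 < s < k together with the k non-multiples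
-- (jm+w)k+s, j < k, all of which multiplication by k sends to (wk+s)k; a k-free set meets each group in
-- at most k elements. Conversely, all non-multiples of k together with k²·A, for A ⊆ ℤ/mℤ k-free of
-- size R_k(m), form a k-free set meeting every group in k elements.

module Submission where

open import Defs
open import Data.Bool using (Bool; true; false)
open import Data.Bool.Properties using (¬-not)
open import Data.Fin using (Fin; zero; suc; toℕ)
open import Data.Fin.Properties using (toℕ-fromℕ<; toℕ<n; toℕ-injective)
open import Data.Fin.Subset using (Subset; _∈_; ∣_∣)
open import Data.Nat using (ℕ; zero; suc; _+_; _*_; _∸_; _≤_; _<_; NonZero; _%_; _/_; z≤n; s≤s)
open import Data.Nat.Divisibility using (divides-refl; m∣m*n)
open import Data.Nat.DivMod
open import Data.Nat.Properties
open import Data.Nat.Tactic.RingSolver using (solve-∀)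
open import Data.Product using (Σ; _×_; _,_)
open import Data.Vec using ([]; _∷_; tabulate; here; there)
open import Function using (_∘_; _$_)
open import Relation.Binary.PropositionalEquality

∑ : ℕ → (ℕ → ℕ) → ℕ
∑ zero    f = 0
∑ (suc n) f = f 0 + ∑ n (f ∘ suc)

syntax ∑ n (λ i → e) = ∑[ i < n ] e

∑-cong : ∀ n {f g : ℕ → ℕ} → (∀ i → i < n → f i ≡ g i) → ∑ n f ≡ ∑ n g
∑-cong zero    f≗g = refl
∑-cong (suc n) f≗g = cong₂ _+_ (f≗g 0 (s≤s z≤n)) (∑-cong n (λ i i<n → f≗g (suc i) (s≤s i<n)))

∑-mono-≤ : ∀ n {f g : ℕ → ℕ} → (∀ i → i < n → f i ≤ g i) → ∑ n f ≤ ∑ n g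
∑-mono-≤ zero    f≤g = z≤n
∑-mono-≤ (suc n) f≤g = +-mono-≤ (f≤g 0 (s≤s z≤n)) (∑-mono-≤ n (λ i i<n → f≤g (suc i) (s≤s i<n)))

∑-const : ∀ n c → ∑[ _ < n ] c ≡ n * c
∑-const zero    c = refl
∑-const (suc n) c = cong (c +_) (∑-const n c)

∑-distrib-+ : ∀ n (f g : ℕ → ℕ) → ∑[ i < n ] (f i + g i) ≡ ∑ n f + ∑ n g
∑-distrib-+ zero    f g = refl
∑-distrib-+ (suc n) f g = begin
  (f 0 + g 0) + ∑[ i < n ] (f (suc i) + g (suc i)) ≡⟨ cong (f 0 + g 0 +_) (∑-distrib-+ n _ _) ⟩
  (f 0 + g 0) + (∑ n (f ∘ suc) + ∑ n (g ∘ suc))    ≡⟨ +-comm-middle (f 0) (g 0) _ _ ⟩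
  (f 0 + ∑ n (f ∘ suc)) + (g 0 + ∑ n (g ∘ suc))    ∎
  where
  open ≡-Reasoning
  +-comm-middle : ∀ a b c d → (a + b) + (c + d) ≡ (a + c) + (b + d)
  +-comm-middle = solve-∀

∑-++ : ∀ a b (f : ℕ → ℕ) → ∑ (a + b) f ≡ ∑ a f + ∑[ i < b ] f (a + i)
∑-++ zero    b f = refl
∑-++ (suc a) b f = trans (cong (f 0 +_) (∑-++ a b (f ∘ suc))) (sym (+-assoc (f 0) _ _))

∑-* : ∀ d c (f : ℕ → ℕ) → ∑ (d * c) f ≡ ∑[ y < d ] ∑[ i < c ] f (y * c + i)
∑-* zero    c f = refl
∑-* (suc d) c f = trans (∑-++ c (d * c) f) (cong (∑ c f +_) (trans (∑-* d c (λ i → f (c + i)))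
  (∑-cong d (λ y _ → ∑-cong c (λ i _ → cong f (sym (+-assoc c (y * c) i)))))))

∑-comm : ∀ d c (f : ℕ → ℕ → ℕ) → ∑[ y < d ] ∑[ i < c ] f y i ≡ ∑[ i < c ] ∑[ y < d ] f y i
∑-comm zero    c f = sym (trans (∑-const c 0) (*-zeroʳ c))
∑-comm (suc d) c f = trans (cong (∑ c (f 0) +_) (∑-comm d c (f ∘ suc)))
  (sym (∑-distrib-+ c (f 0) (λ i → ∑[ y < d ] f (suc y) i)))

∑-multiples : ∀ d c (f : ℕ → ℕ) →
  ∑ (d * suc c) f ≡ ∑[ y < d ] (f (y * suc c) + ∑[ i < c ] f (y * suc c + suc i))
∑-multiples d c f = trans (∑-* d (suc c) f)
  (∑-cong d (λ y _ → cong (λ z → f z + ∑[ i < c ] f (y * suc c + suc i)) (+-identityʳ (y * suc c))))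

boolToℕ : Bool → ℕ
boolToℕ false = 0
boolToℕ true  = 1

false≢true : false ≢ true
false≢true ()

∑-boolToℕ-≤ : ∀ n (p : ℕ → Bool) → ∑[ i < n ] boolToℕ (p i) ≤ n
∑-boolToℕ-≤ n p = begin
  ∑[ i < n ] boolToℕ (p i) ≤⟨ ∑-mono-≤ n (λ i _ → bit≤1 (p i)) ⟩
  ∑[ _ < n ] 1             ≡⟨ trans (∑-const n 1) (*-identityʳ n) ⟩
  n                        ∎
  where
  open ≤-Reasoning
  bit≤1 : ∀ b → boolToℕ b ≤ 1
  bit≤1 false = z≤n
  bit≤1 true  = s≤s z≤n

-- Membership of a natural number in A; numbers beyond the range are never members.
χ : ∀ {n} → Subset n → ℕ → Bool
χ []      _       = false
χ (b ∷ A) zero    = b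
χ (b ∷ A) (suc x) = χ A x

subset : (n : ℕ) → (ℕ → Bool) → Subset n
subset n p = tabulate (p ∘ toℕ)

∣∣≡∑χ : ∀ {n} (A : Subset n) → ∣ A ∣ ≡ ∑[ x < n ] boolToℕ (χ A x)
∣∣≡∑χ []          = refl
∣∣≡∑χ (true ∷ A)  = cong suc (∣∣≡∑χ A)
∣∣≡∑χ (false ∷ A) = ∣∣≡∑χ A

χ-∈ : ∀ {n} {A : Subset n} {i} → i ∈ A → χ A (toℕ i) ≡ true
χ-∈ here        = refl
χ-∈ (there i∈A) = χ-∈ i∈A

χ⇒∈ : ∀ {n} (A : Subset n) x → χ A x ≡ true → Σ (Fin n) λ i → toℕ i ≡ x × i ∈ A
χ⇒∈ (true ∷ A) zero    refl = zero , refl , here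
χ⇒∈ (b ∷ A)    (suc x) χx with χ⇒∈ A x χx
... | i , refl , i∈A = suc i , refl , there i∈A

χ-subset : ∀ n p x → x < n → χ (subset n p) x ≡ p x
χ-subset (suc n) p zero    _         = refl
χ-subset (suc n) p (suc x) (s≤s x<n) = χ-subset n (p ∘ suc) x x<n

∣subset∣ : ∀ n p → ∣ subset n p ∣ ≡ ∑[ x < n ] boolToℕ (p x)
∣subset∣ n p = trans (∣∣≡∑χ (subset n p)) (∑-cong n (λ x x<n → cong boolToℕ (χ-subset n p x x<n)))

KFreeᵖ : (n : ℕ) .{{_ : NonZero n}} → ℕ → (ℕ → Bool) → Set
KFreeᵖ n k p = ∀ x → p x ≡ true → p (k * x % n) ≡ false

χ-kfree : ∀ {n} .{{_ : NonZero n}} {k} {A : Subset n} → KFree n k A → KFreeᵖ n k (χ A)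
χ-kfree {n} {k} {A} A-free x χx with χ⇒∈ A x χx
... | i , refl , i∈A = ¬-not λ χkx → let (j , j≡ki , j∈A) = χ⇒∈ A _ χkx in
  A-free i i∈A (subst (_∈ A) (toℕ-injective (trans j≡ki (sym (toℕ-fromℕ< _)))) j∈A)

subset-kfree : ∀ {n} .{{_ : NonZero n}} {k p} → KFreeᵖ n k p → KFree n k (subset n p)
subset-kfree {n} {k} {p} p-free i i∈ ki∈ = false≢true $ begin
  false                  ≡⟨ p-free (toℕ i) (member i∈) ⟨
  p (k * toℕ i % n)      ≡⟨ cong p (toℕ-fromℕ< _) ⟨
  p (toℕ (mulMod n k i)) ≡⟨ member ki∈ ⟩
  true                   ∎
  where
  open ≡-Reasoning
  member : ∀ {j} → j ∈ subset n p → p (toℕ j) ≡ true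
  member {j} j∈ = trans (sym (χ-subset n p (toℕ j) (toℕ<n j))) (χ-∈ j∈)

[m*n+o]%n≡o : ∀ m {n o} .{{_ : NonZero n}} → o < n → (m * n + o) % n ≡ o
[m*n+o]%n≡o m {n} {o} o<n = trans (cong (_% n) (+-comm (m * n) o)) (trans ([m+kn]%n≡m%n o m n) (m<n⇒m%n≡m o<n))

[m*n+o]/n≡m : ∀ m {n o} .{{_ : NonZero n}} → o < n → (m * n + o) / n ≡ m
[m*n+o]/n≡m m {n} {o} o<n = begin
  (m * n + o) / n   ≡⟨ +-distrib-/-∣ˡ o (divides-refl m) ⟩
  m * n / n + o / n ≡⟨ cong₂ _+_ (m*n/n≡m m n) (m<n⇒m/n≡0 o<n) ⟩
  m + 0             ≡⟨ +-identityʳ m ⟩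
  m                 ∎
  where open ≡-Reasoning

m*n+o<p*n : ∀ {m n o p} → m < p → o < n → m * n + o < p * n
m*n+o<p*n {m} {n} {o} {p} m<p o<n = begin-strict
  m * n + o ≡⟨ +-comm (m * n) o ⟩
  o + m * n <⟨ +-monoˡ-< (m * n) o<n ⟩
  suc m * n ≤⟨ *-monoˡ-≤ n m<p ⟩
  p * n     ∎
  where open ≤-Reasoning

module Residues (k′ m′ : ℕ) where

  k m n : ℕ
  k = suc k′
  m = suc m′
  n = k * k * m

  n≡k*m*k : n ≡ k * m * k
  n≡k*m*k = trans (*-assoc k k m) (trans (cong (k *_) (*-comm k m)) (sym (*-assoc k m k)))

  k*x%n≡x%[k*m]*k : ∀ x → k * x % n ≡ x % (k * m) * k
  k*x%n≡x%[k*m]*k x = begin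
    k * x % n           ≡⟨ cong (_% n) (*-comm k x) ⟩
    x * k % n           ≡⟨ %-congʳ {o = x * k} n≡k*m*k ⟩
    x * k % (k * m * k) ≡⟨ m%n*o≡m*o%[n*o] x (k * m) k ⟨
    x % (k * m) * k     ∎
    where open ≡-Reasoning

  k*[w*k*k]%n≡[k*w%m]*k*k : ∀ w → k * (w * k * k) % n ≡ k * w % m * k * k
  k*[w*k*k]%n≡[k*w%m]*k*k w = begin
    k * (w * k * k) % n     ≡⟨ k*x%n≡x%[k*m]*k (w * k * k) ⟩
    w * k * k % (k * m) * k ≡⟨ cong (_* k) (%-congʳ {o = w * k * k} (*-comm k m)) ⟩
    w * k * k % (m * k) * k ≡⟨ cong (_* k) (m%n*o≡m*o%[n*o] (w * k) m k) ⟨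
    w * k % m * k * k       ≡⟨ cong (λ z → z % m * k * k) (*-comm w k) ⟩
    k * w % m * k * k       ∎
    where open ≡-Reasoning

  k*[[j*m+w]*k+s]%n≡[w*k+s]*k : ∀ j {w s} → w < m → s < k → k * ((j * m + w) * k + s) % n ≡ (w * k + s) * k
  k*[[j*m+w]*k+s]%n≡[w*k+s]*k j {w} {s} w<m s<k = begin
    k * ((j * m + w) * k + s) % n       ≡⟨ k*x%n≡x%[k*m]*k ((j * m + w) * k + s) ⟩
    ((j * m + w) * k + s) % (k * m) * k ≡⟨ cong (λ z → z % (k * m) * k) (regroup j m w k s) ⟩
    (w * k + s + j * (k * m)) % (k * m) * k ≡⟨ cong (_* k) ([m+kn]%n≡m%n (w * k + s) j (k * m)) ⟩
    (w * k + s) % (k * m) * k           ≡⟨ cong (_* k) (m<n⇒m%n≡m w*k+s<k*m) ⟩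
    (w * k + s) * k                     ∎
    where
    open ≡-Reasoning
    regroup : ∀ j m w k s → (j * m + w) * k + s ≡ w * k + s + j * (k * m)
    regroup = solve-∀
    w*k+s<k*m : w * k + s < k * m
    w*k+s<k*m = subst (w * k + s <_) (*-comm m k) (m*n+o<p*n w<m s<k)

  ∑-residues : ∀ (a : ℕ → ℕ) → ∑ n a ≡
    ∑[ w < m ] a (w * k * k) +
    ∑[ w < m ] ∑[ i < k′ ] (a ((w * k + suc i) * k) + ∑[ j < k ] a ((j * m + w) * k + suc i))
  ∑-residues a = begin
    ∑ n a                                          ≡⟨ cong (λ z → ∑ z a) n≡k*m*k ⟩
    ∑ (k * m * k) a                                ≡⟨ ∑-multiples (k * m) k′ a ⟩
    ∑[ y < k * m ] (a (y * k) + block y)           ≡⟨ ∑-distrib-+ (k * m) (λ y → a (y * k)) block ⟩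
    ∑[ y < k * m ] a (y * k) + ∑ (k * m) block     ≡⟨ cong₂ _+_ multiples nonmultiples ⟩
    (core + ∑[ w < m ] ∑ k′ (exact w)) + ∑[ w < m ] ∑ k′ (preimages w)
      ≡⟨ +-assoc core _ _ ⟩
    core + (∑[ w < m ] ∑ k′ (exact w) + ∑[ w < m ] ∑ k′ (preimages w))
      ≡⟨ cong (core +_) (∑-distrib-+ m (∑ k′ ∘ exact) (∑ k′ ∘ preimages)) ⟨
    core + ∑[ w < m ] (∑ k′ (exact w) + ∑ k′ (preimages w))
      ≡⟨ cong (core +_) (∑-cong m (λ w _ → ∑-distrib-+ k′ (exact w) (preimages w))) ⟨
    core + ∑[ w < m ] ∑[ i < k′ ] (exact w i + preimages w i) ∎
    where
    open ≡-Reasoning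
    block : ℕ → ℕ
    block y = ∑[ i < k′ ] a (y * k + suc i)
    core : ℕ
    core = ∑[ w < m ] a (w * k * k)
    exact preimages : ℕ → ℕ → ℕ
    exact w i = a ((w * k + suc i) * k)
    preimages w i = ∑[ j < k ] a ((j * m + w) * k + suc i)
    multiples : ∑[ y < k * m ] a (y * k) ≡ core + ∑[ w < m ] ∑ k′ (exact w)
    multiples = begin
      ∑[ y < k * m ] a (y * k)                     ≡⟨ cong (λ z → ∑[ y < z ] a (y * k)) (*-comm k m) ⟩
      ∑[ y < m * k ] a (y * k)                     ≡⟨ ∑-multiples m k′ (λ y → a (y * k)) ⟩
      ∑[ w < m ] (a (w * k * k) + ∑ k′ (exact w))  ≡⟨ ∑-distrib-+ m (λ w → a (w * k * k)) (∑ k′ ∘ exact) ⟩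
      core + ∑[ w < m ] ∑ k′ (exact w)             ∎
    nonmultiples : ∑ (k * m) block ≡ ∑[ w < m ] ∑ k′ (preimages w)
    nonmultiples = begin
      ∑ (k * m) block                            ≡⟨ ∑-* k m block ⟩
      ∑[ j < k ] ∑[ w < m ] block (j * m + w)    ≡⟨ ∑-comm k m (λ j w → block (j * m + w)) ⟩
      ∑[ w < m ] ∑[ j < k ] block (j * m + w)
        ≡⟨ ∑-cong m (λ w _ → ∑-comm k k′ (λ j i → a ((j * m + w) * k + suc i))) ⟩
      ∑[ w < m ] ∑ k′ (preimages w)              ∎

  ∑∑-k : ∑[ _ < m ] ∑[ _ < k′ ] k ≡ (k * k ∸ k) * m
  ∑∑-k = begin
    ∑[ _ < m ] ∑[ _ < k′ ] k ≡⟨ ∑-cong m (λ _ _ → ∑-const k′ k) ⟩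
    ∑[ _ < m ] (k′ * k)      ≡⟨ ∑-const m (k′ * k) ⟩
    m * (k′ * k)             ≡⟨ *-comm m (k′ * k) ⟩
    k′ * k * m               ≡⟨ cong (_* m) (m+n∸m≡n k (k′ * k)) ⟨
    (k * k ∸ k) * m          ∎
    where open ≡-Reasoning

  restrict : (ℕ → Bool) → ℕ → Bool
  restrict p w = p (w * k * k)

  restrict-kfree : ∀ {p} → KFreeᵖ n k p → KFreeᵖ m k (restrict p)
  restrict-kfree {p} p-free w pw = subst (λ x → p x ≡ false) (k*[w*k*k]%n≡[k*w%m]*k*k w) (p-free _ pw)

  fibre-≤ : ∀ {p} → KFreeᵖ n k p → ∀ {w i} → w < m → suc i < k →
    boolToℕ (p ((w * k + suc i) * k)) + ∑[ j < k ] boolToℕ (p ((j * m + w) * k + suc i)) ≤ k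
  fibre-≤ {p} p-free {w} {i} w<m i<k with p ((w * k + suc i) * k) in image
  ... | false = ∑-boolToℕ-≤ k (λ j → p ((j * m + w) * k + suc i))
  ... | true  = subst (λ t → 1 + t ≤ k) (sym ∑≡0) (s≤s z≤n)
    where
    preimage-∉ : ∀ j → p ((j * m + w) * k + suc i) ≡ false
    preimage-∉ j = ¬-not λ pj → false≢true $ trans
      (sym (subst (λ x → p x ≡ false) (k*[[j*m+w]*k+s]%n≡[w*k+s]*k j w<m i<k) (p-free _ pj))) image
    ∑≡0 : ∑[ j < k ] boolToℕ (p ((j * m + w) * k + suc i)) ≡ 0
    ∑≡0 = trans (∑-cong k (λ j _ → cong boolToℕ (preimage-∉ j))) (trans (∑-const k 0) (*-zeroʳ k))

  ∑-kfree-≤ : ∀ {p} → KFreeᵖ n k p →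
    ∑[ x < n ] boolToℕ (p x) ≤ ∑[ w < m ] boolToℕ (restrict p w) + (k * k ∸ k) * m
  ∑-kfree-≤ {p} p-free = begin
    ∑[ x < n ] boolToℕ (p x)             ≡⟨ ∑-residues (boolToℕ ∘ p) ⟩
    core + _                             ≤⟨ +-monoʳ-≤ core (∑-mono-≤ m (λ w w<m →
                                              ∑-mono-≤ k′ (λ i i<k′ → fibre-≤ p-free w<m (s≤s i<k′)))) ⟩
    core + ∑[ _ < m ] ∑[ _ < k′ ] k      ≡⟨ cong (core +_) ∑∑-k ⟩
    core + (k * k ∸ k) * m               ∎
    where
    open ≤-Reasoning
    core : ℕ
    core = ∑[ w < m ] boolToℕ (restrict p w)

  -- The non-multiples of k together with k²·p, read off the two lowest base-k digits.
  extendDigits : (ℕ → Bool) → ℕ → ℕ → ℕ → Bool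
  extendDigits p (suc _) _       _ = true
  extendDigits p zero    (suc _) _ = false
  extendDigits p zero    zero    w = p w

  extend : (ℕ → Bool) → ℕ → Bool
  extend p x = extendDigits p (x % k) (x / k % k) (x / k / k)

  extend-digits : ∀ p y {s} → s < k → extend p (y * k + s) ≡ extendDigits p s (y % k) (y / k)
  extend-digits p y s<k rewrite [m*n+o]%n≡o y s<k | [m*n+o]/n≡m y s<k = refl

  extend-multiple : ∀ p y → extend p (y * k) ≡ extendDigits p 0 (y % k) (y / k)
  extend-multiple p y = trans (cong (extend p) (sym (+-identityʳ (y * k)))) (extend-digits p y (s≤s z≤n))

  extend-k² : ∀ p w → extend p (w * k * k) ≡ p w
  extend-k² p w = trans (extend-multiple p (w * k)) (cong₂ (extendDigits p 0) (m*n%n≡0 w k) (m*n/n≡m w k))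

  extend-k¹ : ∀ p w {i} → suc i < k → extend p ((w * k + suc i) * k) ≡ false
  extend-k¹ p w {i} i<k = trans (extend-multiple p (w * k + suc i))
    (cong (λ d → extendDigits p 0 d ((w * k + suc i) / k)) ([m*n+o]%n≡o w i<k))

  extend-k⁰ : ∀ p y {i} → suc i < k → extend p (y * k + suc i) ≡ true
  extend-k⁰ p y i<k rewrite extend-digits p y i<k = refl

  extend-kfree : ∀ {p} → KFreeᵖ m k p → KFreeᵖ n k (extend p)
  extend-kfree {p} p-free x px with x % k in x%k | x / k % k in x/k%k
  ... | suc _ | _ = begin
    extend p (k * x % n)                   ≡⟨ cong (extend p) (k*x%n≡x%[k*m]*k x) ⟩
    extend p (y * k)                       ≡⟨ extend-multiple p y ⟩
    extendDigits p 0 (y % k) (y / k)       ≡⟨ cong (λ d → extendDigits p 0 d (y / k)) y%k≡x%k ⟩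
    extendDigits p 0 (x % k) (y / k)       ≡⟨ cong (λ d → extendDigits p 0 d (y / k)) x%k ⟩
    false                                  ∎
    where
    open ≡-Reasoning
    y : ℕ
    y = x % (k * m)
    y%k≡x%k : y % k ≡ x % k
    y%k≡x%k = m∣n⇒o%n%m≡o%m k (k * m) x (m∣m*n m)
  ... | zero | zero = begin
    extend p (k * x % n)             ≡⟨ cong (λ y → extend p (k * y % n)) x≡w*k*k ⟩
    extend p (k * (w * k * k) % n)   ≡⟨ cong (extend p) (k*[w*k*k]%n≡[k*w%m]*k*k w) ⟩
    extend p (k * w % m * k * k)     ≡⟨ extend-k² p (k * w % m) ⟩
    p (k * w % m)                    ≡⟨ p-free w px ⟩
    false                            ∎
    where
    open ≡-Reasoning
    w : ℕ
    w = x / k / k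
    x≡w*k*k : x ≡ w * k * k
    x≡w*k*k = begin
      x                          ≡⟨ m≡m%n+[m/n]*n x k ⟩
      x % k + x / k * k          ≡⟨ cong (λ d → d + x / k * k) x%k ⟩
      x / k * k                  ≡⟨ cong (_* k) (m≡m%n+[m/n]*n (x / k) k) ⟩
      (x / k % k + w * k) * k    ≡⟨ cong (λ d → (d + w * k) * k) x/k%k ⟩
      w * k * k                  ∎

  ∑-extend : ∀ p → ∑[ x < n ] boolToℕ (extend p x) ≡ ∑[ w < m ] boolToℕ (p w) + (k * k ∸ k) * m
  ∑-extend p = begin
    ∑[ x < n ] boolToℕ (extend p x) ≡⟨ ∑-residues (boolToℕ ∘ extend p) ⟩
    ∑[ w < m ] boolToℕ (extend p (w * k * k)) + ∑[ w < m ] ∑[ i < k′ ] fibre w i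
      ≡⟨ cong₂ _+_ (∑-cong m (λ w _ → cong boolToℕ (extend-k² p w)))
                   (trans (∑-cong m (λ w _ → ∑-cong k′ (λ i i<k′ → fibre≡k w (s≤s i<k′)))) ∑∑-k) ⟩
    ∑[ w < m ] boolToℕ (p w) + (k * k ∸ k) * m ∎
    where
    open ≡-Reasoning
    fibre : ℕ → ℕ → ℕ
    fibre w i = boolToℕ (extend p ((w * k + suc i) * k))
              + ∑[ j < k ] boolToℕ (extend p ((j * m + w) * k + suc i))
    fibre≡k : ∀ w {i} → suc i < k → fibre w i ≡ k
    fibre≡k w i<k = cong₂ _+_ (cong boolToℕ (extend-k¹ p w i<k))
      (trans (∑-cong k (λ j _ → cong boolToℕ (extend-k⁰ p (j * m + w) i<k)))
             (trans (∑-const k 1) (*-identityʳ k)))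

  ∣subset-extend∣ : ∀ (A : Subset m) → ∣ subset n (extend (χ A)) ∣ ≡ ∣ A ∣ + (k * k ∸ k) * m
  ∣subset-extend∣ A = begin
    ∣ subset n (extend (χ A)) ∣                   ≡⟨ ∣subset∣ n (extend (χ A)) ⟩
    ∑[ x < n ] boolToℕ (extend (χ A) x)           ≡⟨ ∑-extend (χ A) ⟩
    ∑[ w < m ] boolToℕ (χ A w) + (k * k ∸ k) * m  ≡⟨ cong (_+ (k * k ∸ k) * m) (∣∣≡∑χ A) ⟨
    ∣ A ∣ + (k * k ∸ k) * m                       ∎
    where open ≡-Reasoning

  ∣∣≤∣subset-restrict∣ : ∀ {B : Subset n} → KFree n k B →
    ∣ B ∣ ≤ ∣ subset m (restrict (χ B)) ∣ + (k * k ∸ k) * m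
  ∣∣≤∣subset-restrict∣ {B} B-free = begin
    ∣ B ∣                                                   ≡⟨ ∣∣≡∑χ B ⟩
    ∑[ x < n ] boolToℕ (χ B x)                              ≤⟨ ∑-kfree-≤ (χ-kfree {k = k} B-free) ⟩
    ∑[ w < m ] boolToℕ (restrict (χ B) w) + (k * k ∸ k) * m
      ≡⟨ cong (_+ (k * k ∸ k) * m) (∣subset∣ m (restrict (χ B))) ⟨
    ∣ subset m (restrict (χ B)) ∣ + (k * k ∸ k) * m         ∎
    where open ≤-Reasoning

theorem3 : (k m : ℕ) → 1 ≤ k → 1 ≤ m →
    .{{_ : NonZero m}} → .{{_ : NonZero (k * k * m)}} →
    ∀ r → IsRk k m r → IsRk k (k * k * m) (r + (k * k ∸ k) * m)
theorem3 (suc k′) (suc m′) _ _ r ((A , A-free , ∣A∣≡r) , A-max) =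
  ( subset n (extend (χ A))
  , subset-kfree {k = k} {p = extend (χ A)} (extend-kfree (χ-kfree {k = k} A-free))
  , trans (∣subset-extend∣ A) (cong (_+ (k * k ∸ k) * m) ∣A∣≡r) )
  , λ B B-free → ≤-trans (∣∣≤∣subset-restrict∣ B-free) (+-monoˡ-≤ ((k * k ∸ k) * m)
      (A-max _ (subset-kfree {k = k} {p = restrict (χ B)} (restrict-kfree (χ-kfree {k = k} B-free)))))
  where open Residues k′ m′
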